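{- Let $(X,\mathcal B)$ be a Steiner system $S(2,\ell,m)$ with $m>\ell$, where $X=[m]$ and $\mathcal B=\{B_1,\dots,B_b\}$, $b=|\mathcal B|$. For $j\in[m]$ let $C_j=\{i\in[b]: j\in B_i\}$. Then $\{C_1,\dots,C_m\}$ is a $(b,\ell b,k,m;r)$-MCBC for any integers $r,k$ with $\lfloor\frac{\ell}{2}\rfloor+1\leq r\leq \ell$ and $r\le k\leq (\ell-r+1)(2r-1)$.
   Context: A Steiner system $S(2,\ell,m)$ is a pair $(X,\mathcal B)$ where $X$ is a set of $m$ points and $\mathcal B$ is a collection of $\ell$-subsets (blocks) of $X$ such that every pair of distinct points of $X$ lies in exactly one block. An $(n,N,k,m;r)$ multiset combinatorial batch code (MCBC) is a collection $\mathcal C=\{C_1,\dots,C_m\}$ of subsets of $[n]=\{1,\dots,n\}$ (servers) with $N=\sum_{j=1}^m|C_j|$, such that for every multiset request $\{i_1,\dots,i_k\}$ of $k$ elements of $[n]$ in which every element has multiplicity at most $r$, there exist subsets $D_j\subseteq C_j$ with $|D_j|\le 1$ ($j\in[m]$) whose multiset union (the multiplicity of $i$ being $|\{j: i\in D_j\}|$) contains the request. -}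

module Defs where

open import Data.Nat using (ℕ; zero; suc; _+_; _≤_)
open import Data.Fin using (Fin; zero; suc; _≟_)
open import Data.Fin.Subset using (Subset; _∈_; ∣_∣)
open import Data.Vec using (tabulate; lookup)
open import Data.Maybe using (Maybe; just; nothing)
open import Data.Product using (_×_; ∃; ∃!)
open import Relation.Binary.PropositionalEquality using (_≡_; _≢_)
open import Relation.Nullary using (yes; no)

∑ : ∀ {n} → (Fin n → ℕ) → ℕ
∑ {zero}  f = 0
∑ {suc n} f = f zero + ∑ (λ i → f (suc i))

record IsSteiner (ℓ m b : ℕ) (B : Fin b → Subset m) : Set where
  field
    blockSize : ∀ i → ∣ B i ∣ ≡ ℓ
    pairUnique : ∀ (x y : Fin m) → x ≢ y → ∃! _≡_ (λ i → x ∈ B i × y ∈ B i)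

dualSets : ∀ {m b} → (Fin b → Subset m) → Fin m → Subset b
dualSets B j = tabulate (λ i → lookup (B i) j)

hit : ∀ {n} → Maybe (Fin n) → Fin n → ℕ
hit nothing  i = 0
hit (just i') i with i' ≟ i
... | yes _ = 1
... | no  _ = 0

-- Multiset request of k elements of [n]: multiplicity function with total k.
-- A choice D_j ⊆ C_j with |D_j| ≤ 1 is d j : Maybe (Fin n) (nothing = D_j empty).
IsMCBC : (n N k m r : ℕ) → (Fin m → Subset n) → Set
IsMCBC n N k m r C =
  N ≡ ∑ (λ j → ∣ C j ∣) ×
  (∀ (req : Fin n → ℕ) → ∑ req ≡ k → (∀ i → req i ≤ r) →
     ∃ λ (d : Fin m → Maybe (Fin n)) →
       (∀ j i → d j ≡ just i → i ∈ C j) ×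
       (∀ i → req i ≤ ∑ (λ j → hit (d j) i)))

module Submission where

-- Servers are the points j of the Steiner system, items are its blocks i, and
-- server j stores item i when j ∈ B_i.  A multiset request is a demand function
-- req on items, and serving it means choosing for every server at most one item
-- it stores so that item i is chosen at least req i times.  The proof has three
-- independent ingredients:
--   * Hall's theorem with multiplicities (Section 3): a bipartite relation E
--     serves req as soon as every set T of items has total demand at most the
--     number of servers adjacent to T.  Proved by induction on the number of
--     servers, using modularity of the demand and submodularity of the
--     neighbourhood size to shrink a violating set.
--   * A union bound (Section 4): t blocks of size ℓ that pairwise share at most
--     one point cover at least  coverage ℓ t = ℓ + (ℓ-1) + … + (ℓ-t+1)  points.
--   * An arithmetic inequality (Section 5): under the hypotheses on ℓ, r, k a
--     set of t items of demand D ≤ min(t·r, k) satisfies D ≤ coverage ℓ t.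
-- Together they verify Hall's condition; the storage count ℓ·b is a double
-- count of the incidences (Section 6).

open import Defs
open import Algebra using (CommutativeMonoid)
open import Data.Bool using (Bool; true; false; _∧_; _∨_; not)
open import Data.Bool.Properties using (∨-zeroʳ; ∧-zeroʳ; ∧-distribʳ-∨; ∨-commutativeMonoid) renaming (_≟_ to _≟ᵇ_)
open import Data.Empty using (⊥-elim)
open import Data.Fin using (Fin; zero; suc; _≟_)
open import Data.Fin.Properties using (any?) renaming (suc-injective to Fin-suc-injective)
open import Data.Fin.Subset using (Subset; _∈_; ∣_∣; _∪_; _∩_; ⊤)
open import Data.Fin.Subset.Properties using (anySubset?)
open import Data.Maybe using (Maybe; just; nothing)
open import Data.Nat using (ℕ; zero; suc; _+_; _*_; _∸_; _≤_; _<_; _≤′_; ≤′-refl; ≤′-step; z≤n; s≤s; _≤?_)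
open import Data.Nat.DivMod using (_/_; _%_; m≡m%n+[m/n]*n; m%n<n)
open import Data.Nat.Properties hiding (_≟_)
open import Data.Nat.Tactic.RingSolver using (solve-∀)
open import Data.Product using (_×_; _,_; ∃; proj₁; proj₂)
open import Data.Sum using (_⊎_; inj₁; inj₂)
open import Data.Vec using ([]; _∷_; lookup; tabulate)
open import Data.Vec.Properties using (lookup∘tabulate; lookup-zipWith; lookup-replicate; lookup⇒[]=)
open import Relation.Binary.PropositionalEquality
open import Relation.Nullary using (¬_; Dec; yes; no; ¬?; _×-dec_)
open import Relation.Nullary.Decidable using (decidable-stable)

import Algebra.Properties.CommutativeSemigroup as CommSemigroupProperties
open CommSemigroupProperties +-commutativeSemigroup using () renaming (interchange to +-interchange)
open CommSemigroupProperties (CommutativeMonoid.commutativeSemigroup ∨-commutativeMonoid)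
  using () renaming (interchange to ∨-interchange)


-- 1. Finite sums over Fin n

∑-cong : ∀ {n} {f g : Fin n → ℕ} → (∀ i → f i ≡ g i) → ∑ f ≡ ∑ g
∑-cong {zero}  h = refl
∑-cong {suc n} h = cong₂ _+_ (h zero) (∑-cong (λ i → h (suc i)))

∑-mono : ∀ {n} {f g : Fin n → ℕ} → (∀ i → f i ≤ g i) → ∑ f ≤ ∑ g
∑-mono {zero}  h = z≤n
∑-mono {suc n} h = +-mono-≤ (h zero) (∑-mono (λ i → h (suc i)))

∑-strict : ∀ {n} {f g : Fin n → ℕ} → (∀ i → f i ≤ g i) → ∀ i → f i < g i → ∑ f < ∑ g
∑-strict {suc n} h zero    lt = +-mono-<-≤ lt (∑-mono (λ i → h (suc i)))
∑-strict {suc n} h (suc i) lt = +-mono-≤-< (h zero) (∑-strict (λ j → h (suc j)) i lt)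

∑-+ : ∀ {n} (f g : Fin n → ℕ) → ∑ (λ i → f i + g i) ≡ ∑ f + ∑ g
∑-+ {zero}  f g = refl
∑-+ {suc n} f g = trans (cong (f zero + g zero +_) (∑-+ (λ i → f (suc i)) (λ i → g (suc i))))
                        (+-interchange (f zero) (g zero) _ _)

∑-const : ∀ {n} c → ∑ {n} (λ _ → c) ≡ n * c
∑-const {zero}  c = refl
∑-const {suc n} c = cong (c +_) (∑-const {n} c)

∑-zero : ∀ {n} → ∑ {n} (λ _ → 0) ≡ 0
∑-zero {n} = trans (∑-const {n} 0) (*-zeroʳ n)

∑-*ʳ : ∀ {n} (f : Fin n → ℕ) c → ∑ (λ i → f i * c) ≡ ∑ f * c
∑-*ʳ {zero}  f c = refl
∑-*ʳ {suc n} f c = trans (cong (f zero * c +_) (∑-*ʳ (λ i → f (suc i)) c))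
                         (sym (*-distribʳ-+ c (f zero) _))

∑-swap : ∀ {n m} (f : Fin n → Fin m → ℕ) → ∑ (λ i → ∑ (f i)) ≡ ∑ (λ j → ∑ (λ i → f i j))
∑-swap {zero}  {m} f = sym (∑-zero {m})
∑-swap {suc n} f = trans (cong (∑ (f zero) +_) (∑-swap (λ i → f (suc i))))
                         (sym (∑-+ (f zero) (λ j → ∑ (λ i → f (suc i) j))))

term≤∑ : ∀ {n} (f : Fin n → ℕ) i → f i ≤ ∑ f
term≤∑ f zero    = m≤m+n _ _
term≤∑ f (suc i) = ≤-trans (term≤∑ (λ j → f (suc j)) i) (m≤n+m _ (f zero))


-- 2. Counting the true values of a Boolean function on Fin n

𝟙 : Bool → ℕ
𝟙 true  = 1
𝟙 false = 0

count : ∀ {n} → (Fin n → Bool) → ℕ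
count g = ∑ (λ x → 𝟙 (g x))

∣∣≡count : ∀ {n} (p : Subset n) → ∣ p ∣ ≡ count (lookup p)
∣∣≡count []          = refl
∣∣≡count (true ∷ p)  = cong suc (∣∣≡count p)
∣∣≡count (false ∷ p) = ∣∣≡count p

𝟙-mono : ∀ {a c} → (a ≡ true → c ≡ true) → 𝟙 a ≤ 𝟙 c
𝟙-mono {false} h = z≤n
𝟙-mono {true}  h rewrite h refl = ≤-refl

count-mono : ∀ {n} {g h : Fin n → Bool} → (∀ x → g x ≡ true → h x ≡ true) → count g ≤ count h
count-mono g⇒h = ∑-mono (λ x → 𝟙-mono (g⇒h x))

𝟙-modular : ∀ a c → 𝟙 (a ∨ c) + 𝟙 (a ∧ c) ≡ 𝟙 a + 𝟙 c
𝟙-modular true  true  = refl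
𝟙-modular true  false = refl
𝟙-modular false true  = refl
𝟙-modular false false = refl

count-modular : ∀ {n} (g h : Fin n → Bool) →
  count (λ x → g x ∨ h x) + count (λ x → g x ∧ h x) ≡ count g + count h
count-modular g h = begin
  count (λ x → g x ∨ h x) + count (λ x → g x ∧ h x)
    ≡⟨ sym (∑-+ (λ x → 𝟙 (g x ∨ h x)) (λ x → 𝟙 (g x ∧ h x))) ⟩
  ∑ (λ x → 𝟙 (g x ∨ h x) + 𝟙 (g x ∧ h x))
    ≡⟨ ∑-cong (λ x → 𝟙-modular (g x) (h x)) ⟩
  ∑ (λ x → 𝟙 (g x) + 𝟙 (h x))
    ≡⟨ ∑-+ (λ x → 𝟙 (g x)) (λ x → 𝟙 (h x)) ⟩
  count g + count h ∎
  where open ≡-Reasoning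

count-witness : ∀ {n} (g : Fin n → Bool) → 1 ≤ count g → ∃ λ x → g x ≡ true
count-witness {suc n} g pos with g zero in gx
... | true  = zero , gx
... | false = let (x , e) = count-witness (λ x → g (suc x)) pos in suc x , e

count-twoWitnesses : ∀ {n} (g : Fin n → Bool) → 2 ≤ count g →
  ∃ λ x → ∃ λ y → x ≢ y × g x ≡ true × g y ≡ true
count-twoWitnesses {suc n} g two with g zero in gx
... | true  = let (y , gy) = count-witness (λ x → g (suc x)) (≤-pred two) in
              zero , suc y , (λ ()) , gx , gy
... | false = let (x , y , x≢y , gx′ , gy) = count-twoWitnesses (λ x → g (suc x)) two in
              suc x , suc y , (λ e → x≢y (Fin-suc-injective e)) , gx′ , gy


-- 3. Hall's theorem with multiplicities
--
-- Items i : Fin b, servers j : Fin m, and E i j says that server j stores item i.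

someIn : ∀ {n} → Subset n → (Fin n → Bool) → Bool
someIn []      g = false
someIn (x ∷ T) g = (x ∧ g zero) ∨ someIn T (λ i → g (suc i))

someIn-intro : ∀ {n} (T : Subset n) g i → lookup T i ≡ true → g i ≡ true → someIn T g ≡ true
someIn-intro (x ∷ T) g zero    refl gi rewrite gi = refl
someIn-intro (x ∷ T) g (suc i) Ti gi =
  trans (cong ((x ∧ g zero) ∨_) (someIn-intro T (λ j → g (suc j)) i Ti gi)) (∨-zeroʳ _)

someIn-witness : ∀ {n} (T : Subset n) g → someIn T g ≡ true → ∃ λ i → lookup T i ≡ true × g i ≡ true
someIn-witness (true ∷ T) g e with g zero in g0
... | true  = zero , refl , g0
... | false = let (i , Ti , gi) = someIn-witness T _ e in suc i , Ti , gi
someIn-witness (false ∷ T) g e = let (i , Ti , gi) = someIn-witness T _ e in suc i , Ti , gi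

someIn-∪ : ∀ {n} (T₁ T₂ : Subset n) g → someIn (T₁ ∪ T₂) g ≡ someIn T₁ g ∨ someIn T₂ g
someIn-∪ []       []       g = refl
someIn-∪ (x ∷ T₁) (y ∷ T₂) g = begin
  ((x ∨ y) ∧ g zero) ∨ someIn (T₁ ∪ T₂) g′ ≡⟨ cong₂ _∨_ (∧-distribʳ-∨ (g zero) x y) (someIn-∪ T₁ T₂ g′) ⟩
  ((x ∧ g zero) ∨ (y ∧ g zero)) ∨ (someIn T₁ g′ ∨ someIn T₂ g′)
    ≡⟨ ∨-interchange (x ∧ g zero) (y ∧ g zero) _ _ ⟩
  ((x ∧ g zero) ∨ someIn T₁ g′) ∨ ((y ∧ g zero) ∨ someIn T₂ g′) ∎
  where
  open ≡-Reasoning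
  g′ : Fin _ → Bool
  g′ i = g (suc i)

∧-true : ∀ {a c} → a ∧ c ≡ true → a ≡ true × c ≡ true
∧-true {true} e = refl , e

someIn-∩ : ∀ {n} (T₁ T₂ : Subset n) g → someIn (T₁ ∩ T₂) g ≡ true → someIn T₁ g ∧ someIn T₂ g ≡ true
someIn-∩ T₁ T₂ g e with someIn-witness (T₁ ∩ T₂) g e
... | i , Ti , gi with ∧-true (trans (sym (lookup-zipWith _∧_ i T₁ T₂)) Ti)
...   | T₁i , T₂i rewrite someIn-intro T₁ g i T₁i gi | someIn-intro T₂ g i T₂i gi = refl

size : ∀ {n} → Subset n → ℕ
size T = count (lookup T)

size-∩-strict : ∀ {n} (T T₂ : Subset n) i → lookup T i ≡ true → lookup T₂ i ≡ false → size (T ∩ T₂) < size T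
size-∩-strict T T₂ i Ti T₂i = ∑-strict (λ x → 𝟙-mono (λ e → proj₁ (∧-true (inMeet x e)))) i dropsI
  where
  inMeet : ∀ x → lookup (T ∩ T₂) x ≡ true → lookup T x ∧ lookup T₂ x ≡ true
  inMeet x = trans (sym (lookup-zipWith _∧_ x T T₂))
  dropsI : 𝟙 (lookup (T ∩ T₂) i) < 𝟙 (lookup T i)
  dropsI rewrite lookup-zipWith _∧_ i T T₂ | Ti | T₂i = s≤s z≤n

neighbours : ∀ {b m} → (Fin b → Fin m → Bool) → Subset b → ℕ
neighbours E T = count (λ j → someIn T (λ i → E i j))

neighbours-mono : ∀ {b m} (E : Fin b → Fin m → Bool) {T′ T} →
  (∀ i → lookup T′ i ≡ true → lookup T i ≡ true) → neighbours E T′ ≤ neighbours E T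
neighbours-mono E {T′} {T} T′⊆T = count-mono (λ j e →
  let (i , T′i , Eij) = someIn-witness T′ (λ i → E i j) e in someIn-intro T (λ i → E i j) i (T′⊆T i T′i) Eij)

keepIf : Bool → ℕ → ℕ
keepIf true  n = n
keepIf false n = 0

demand : ∀ {b} → (Fin b → ℕ) → Subset b → ℕ
demand req T = ∑ (λ i → keepIf (lookup T i) (req i))

keepIf-mono : ∀ a {p q} → p ≤ q → keepIf a p ≤ keepIf a q
keepIf-mono true  p≤q = p≤q
keepIf-mono false _   = z≤n

demand-mono : ∀ {b} {p q : Fin b → ℕ} T → (∀ i → p i ≤ q i) → demand p T ≤ demand q T
demand-mono T p≤q = ∑-mono (λ i → keepIf-mono (lookup T i) (p≤q i))

demand-⊤ : ∀ {b} (req : Fin b → ℕ) → demand req ⊤ ≡ ∑ req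
demand-⊤ req = ∑-cong (λ i → cong (λ a → keepIf a (req i)) (lookup-replicate i true))

demand≤total : ∀ {b} (req : Fin b → ℕ) T → demand req T ≤ ∑ req
demand≤total req T = ∑-mono (λ i → keepIf≤ (lookup T i) (req i))
  where
  keepIf≤ : ∀ a n → keepIf a n ≤ n
  keepIf≤ true  n = ≤-refl
  keepIf≤ false n = z≤n

demand≤size* : ∀ {b} {req : Fin b → ℕ} {r} T → (∀ i → req i ≤ r) → demand req T ≤ size T * r
demand≤size* {req = req} {r} T bounded =
  ≤-trans (∑-mono (λ i → keepIf≤𝟙* (lookup T i) (bounded i))) (≤-reflexive (∑-*ʳ (λ i → 𝟙 (lookup T i)) r))
  where
  keepIf≤𝟙* : ∀ a {n} → n ≤ r → keepIf a n ≤ 𝟙 a * r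
  keepIf≤𝟙* true  n≤r = ≤-trans n≤r (≤-reflexive (sym (+-identityʳ r)))
  keepIf≤𝟙* false _   = z≤n

demand-strict : ∀ {b} {p q : Fin b → ℕ} T i → lookup T i ≡ true → p i < q i →
  (∀ i → p i ≤ q i) → demand p T < demand q T
demand-strict {p = p} {q} T i Ti p<q p≤q =
  ∑-strict (λ x → keepIf-mono (lookup T x) (p≤q x)) i
    (subst (λ a → keepIf a (p i) < keepIf a (q i)) (sym Ti) p<q)

HallCondition : ∀ {b m} → (Fin b → Fin m → Bool) → (Fin b → ℕ) → Set
HallCondition E req = ∀ T → demand req T ≤ neighbours E T

Assignment : ∀ {b m} → (Fin b → Fin m → Bool) → (Fin b → ℕ) → Set
Assignment {b} {m} E req = ∃ λ (d : Fin m → Maybe (Fin b)) →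
  (∀ j i → d j ≡ just i → E i j ≡ true) × (∀ i → req i ≤ ∑ (λ j → hit (d j) i))

demand-modular : ∀ {b} req (T₁ T₂ : Subset b) →
  demand req (T₁ ∪ T₂) + demand req (T₁ ∩ T₂) ≡ demand req T₁ + demand req T₂
demand-modular req T₁ T₂ = begin
  demand req (T₁ ∪ T₂) + demand req (T₁ ∩ T₂)
    ≡⟨ sym (∑-+ (part (T₁ ∪ T₂)) (part (T₁ ∩ T₂))) ⟩
  ∑ (λ i → part (T₁ ∪ T₂) i + part (T₁ ∩ T₂) i)
    ≡⟨ ∑-cong pointwise ⟩
  ∑ (λ i → part T₁ i + part T₂ i)
    ≡⟨ ∑-+ (part T₁) (part T₂) ⟩
  demand req T₁ + demand req T₂ ∎
  where
  open ≡-Reasoning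
  part : Subset _ → Fin _ → ℕ
  part T i = keepIf (lookup T i) (req i)
  keepIf-modular : ∀ x y n → keepIf (x ∨ y) n + keepIf (x ∧ y) n ≡ keepIf x n + keepIf y n
  keepIf-modular true  true  n = refl
  keepIf-modular true  false n = refl
  keepIf-modular false true  n = +-comm n 0
  keepIf-modular false false n = refl
  pointwise : ∀ i → part (T₁ ∪ T₂) i + part (T₁ ∩ T₂) i ≡ part T₁ i + part T₂ i
  pointwise i rewrite lookup-zipWith _∨_ i T₁ T₂ | lookup-zipWith _∧_ i T₁ T₂ =
    keepIf-modular (lookup T₁ i) (lookup T₂ i) (req i)

neighbours-submodular : ∀ {b m} (E : Fin b → Fin m → Bool) T₁ T₂ →
  neighbours E (T₁ ∪ T₂) + neighbours E (T₁ ∩ T₂) ≤ neighbours E T₁ + neighbours E T₂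
neighbours-submodular E T₁ T₂ = begin
  neighbours E (T₁ ∪ T₂) + neighbours E (T₁ ∩ T₂)
    ≡⟨ cong (_+ neighbours E (T₁ ∩ T₂)) (∑-cong (λ j → cong 𝟙 (someIn-∪ T₁ T₂ (col j)))) ⟩
  count (λ j → s₁ j ∨ s₂ j) + neighbours E (T₁ ∩ T₂)
    ≤⟨ +-monoʳ-≤ (count (λ j → s₁ j ∨ s₂ j)) (count-mono (λ j → someIn-∩ T₁ T₂ (col j))) ⟩
  count (λ j → s₁ j ∨ s₂ j) + count (λ j → s₁ j ∧ s₂ j)
    ≡⟨ count-modular s₁ s₂ ⟩
  neighbours E T₁ + neighbours E T₂ ∎
  where
  open ≤-Reasoning
  col : Fin _ → Fin _ → Bool
  col j i = E i j
  s₁ s₂ : Fin _ → Bool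
  s₁ j = someIn T₁ (col j)
  s₂ j = someIn T₂ (col j)

-- Uncrossing: for a modular d dominated by N + 1 and a submodular N, if T₁ and
-- T₂ violate d ≤ N (T₂ by a margin e) then so does T₁ ∩ T₂.
uncross : ∀ e {d∪ d∩ d₁ d₂ n∪ n∩ n₁ n₂} → d∪ + d∩ ≡ d₁ + d₂ → n∪ + n∩ ≤ n₁ + n₂ →
  d∪ ≤ 1 + n∪ → n₁ < d₁ → e + n₂ < d₂ → e + n∩ < d∩
uncross e {d∪} {d∩} {d₁} {d₂} {n∪} {n∩} {n₁} {n₂} mod sub top v₁ v₂ =
  +-cancelˡ-≤ (1 + n∪) _ _ (+-cancelˡ-≤ (n₁ + n₂) _ _ (begin
    n₁ + n₂ + (1 + n∪ + suc (e + n∩)) ≡⟨ solve (n₁ + n₂) n∪ e n∩ ⟩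
    2 + (n₁ + n₂) + (e + (n∪ + n∩))   ≤⟨ +-monoʳ-≤ (2 + (n₁ + n₂)) (+-monoʳ-≤ e sub) ⟩
    2 + (n₁ + n₂) + (e + (n₁ + n₂))   ≡⟨ solve′ n₁ n₂ e ⟩
    suc n₁ + suc (e + n₂) + (n₁ + n₂) ≤⟨ +-monoˡ-≤ (n₁ + n₂) (+-mono-≤ v₁ v₂) ⟩
    d₁ + d₂ + (n₁ + n₂)               ≡⟨ cong (_+ (n₁ + n₂)) (sym mod) ⟩
    d∪ + d∩ + (n₁ + n₂)               ≤⟨ +-monoˡ-≤ (n₁ + n₂) (+-monoˡ-≤ d∩ top) ⟩
    1 + n∪ + d∩ + (n₁ + n₂)           ≡⟨ +-comm (1 + n∪ + d∩) (n₁ + n₂) ⟩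
    n₁ + n₂ + (1 + n∪ + d∩)           ∎))
  where
  open ≤-Reasoning
  solve : ∀ s u w c → s + (1 + u + suc (w + c)) ≡ 2 + s + (w + (u + c))
  solve = solve-∀
  solve′ : ∀ a c w → 2 + (a + c) + (w + (a + c)) ≡ suc a + suc (w + c) + (a + c)
  solve′ = solve-∀

everywhereOrCounterexample : ∀ {n} {P : Subset n → Set} → (∀ T → Dec (P T)) →
  (∀ T → P T) ⊎ ∃ λ T → ¬ P T
everywhereOrCounterexample P? with anySubset? (λ T → ¬? (P? T))
... | yes counterexample = inj₂ counterexample
... | no  none           = inj₁ (λ T → decidable-stable (P? T) (λ ¬PT → none (T , ¬PT)))

hallOrViolation : ∀ {b m} (E : Fin b → Fin m → Bool) req →
  HallCondition E req ⊎ ∃ λ T → neighbours E T < demand req T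
hallOrViolation E req with everywhereOrCounterexample (λ T → demand req T ≤? neighbours E T)
... | inj₁ hall        = inj₁ hall
... | inj₂ (T , ¬hall) = inj₂ (T , ≰⇒> ¬hall)

serveOnce : ∀ {b} → (Fin b → ℕ) → Fin b → Fin b → ℕ
serveOnce req i x = req x ∸ hit (just i) x

serveOnce≤ : ∀ {b} {req : Fin b → ℕ} i x → serveOnce req i x ≤ req x
serveOnce≤ {req = req} i x = m∸n≤m (req x) (hit (just i) x)

hit-self : ∀ {n} (i : Fin n) → hit (just i) i ≡ 1
hit-self i with i ≟ i
... | yes _   = refl
... | no  i≢i = ⊥-elim (i≢i refl)

-- Removing one server from a relation satisfying Hall's condition: either Hall's
-- condition survives, or server zero can be given to an item whose remaining
-- demand satisfies Hall's condition on the other servers.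
module RemoveServerZero {b m} (E : Fin b → Fin (suc m) → Bool) (req : Fin b → ℕ)
                        (hallE : HallCondition E req) where

  rest : Fin b → Fin m → Bool
  rest i j = E i (suc j)

  -- Server zero contributes at most one neighbour.
  demand≤1+rest : ∀ T → demand req T ≤ 1 + neighbours rest T
  demand≤1+rest T = ≤-trans (hallE T) (+-monoˡ-≤ (neighbours rest T) (𝟙≤1 (someIn T (λ i → E i zero))))
    where
    𝟙≤1 : ∀ a → 𝟙 a ≤ 1
    𝟙≤1 true  = ≤-refl
    𝟙≤1 false = z≤n

  -- A set violating Hall's condition for rest contains an item with positive
  -- demand stored on server zero; otherwise dropping the items stored on
  -- server zero would give a violation for E.
  candidate : ∀ T → neighbours rest T < demand req T →
    ∃ λ i → lookup T i ≡ true × E i zero ≡ true × 1 ≤ req i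
  candidate T violated
    with any? (λ i → (lookup T i ≟ᵇ true) ×-dec ((E i zero ≟ᵇ true) ×-dec (1 ≤? req i)))
  ... | yes found = found
  ... | no  none  = ⊥-elim (<-irrefl refl (begin-strict
    demand req T      ≡⟨ ∑-cong sameDemand ⟩
    demand req T′     ≤⟨ hallE T′ ⟩
    neighbours E T′   ≡⟨ cong (λ a → 𝟙 a + neighbours rest T′) avoidsZero ⟩
    neighbours rest T′ ≤⟨ neighbours-mono rest {T′} {T} (λ i T′i → proj₁ (∧-true (inT′ i T′i))) ⟩
    neighbours rest T <⟨ violated ⟩
    demand req T      ∎))
    where
    open ≤-Reasoning
    T′ : Subset b
    T′ = tabulate (λ i → lookup T i ∧ not (E i zero))
    inT′ : ∀ i → lookup T′ i ≡ true → lookup T i ∧ not (E i zero) ≡ true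
    inT′ i = trans (sym (lookup∘tabulate (λ i → lookup T i ∧ not (E i zero)) i))
    sameDemand : ∀ i → keepIf (lookup T i) (req i) ≡ keepIf (lookup T′ i) (req i)
    sameDemand i rewrite lookup∘tabulate (λ i → lookup T i ∧ not (E i zero)) i
      with lookup T i in Ti | E i zero in Ei
    ... | false | _     = refl
    ... | true  | false = refl
    ... | true  | true with 1 ≤? req i
    ...   | yes pos = ⊥-elim (none (i , Ti , Ei , pos))
    ...   | no  ¬pos = n≤0⇒n≡0 (≮⇒≥ ¬pos)
    avoidsZero : someIn T′ (λ i → E i zero) ≡ false
    avoidsZero with someIn T′ (λ i → E i zero) in e
    ... | false = refl
    ... | true with someIn-witness T′ _ e
    ...   | i , T′i , Ei with inT′ i T′i
    ...     | T∧¬E rewrite Ei | ∧-zeroʳ (lookup T i) = sym T∧¬E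

  -- Starting from a violating set T, take its candidate item i.  If the reduced
  -- demand still violates Hall's condition at some T₂, uncrossing shows that
  -- i ∉ T₂ and that T ∩ T₂ is a smaller violating set, so we repeat with it.
  -- The fuel n bounds the size of T.
  reassign : ∀ n T → size T < n → neighbours rest T < demand req T →
    ∃ λ i → E i zero ≡ true × HallCondition rest (serveOnce req i)
  reassign zero    T () violated
  reassign (suc n) T small violated with candidate T violated
  ... | i , Ti , Ei , pos with hallOrViolation rest (serveOnce req i)
  ...   | inj₁ hall = i , Ei , hall
  ...   | inj₂ (T₂ , violated₂) with lookup T₂ i in T₂i
  ...     | true  = ⊥-elim (<⇒≱ meetOverloaded (demand≤1+rest (T ∩ T₂)))
    where
    servedOnce : demand (serveOnce req i) T₂ < demand req T₂
    servedOnce = demand-strict T₂ i T₂i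
                   (subst (λ h → req i ∸ h < req i) (sym (hit-self i)) (∸-monoʳ-< {m = req i} (s≤s z≤n) pos))
                   (serveOnce≤ i)
    meetOverloaded : 1 + neighbours rest (T ∩ T₂) < demand req (T ∩ T₂)
    meetOverloaded = uncross 1 (demand-modular req T T₂) (neighbours-submodular rest T T₂)
                          (demand≤1+rest (T ∪ T₂)) violated (<-≤-trans (s≤s violated₂) servedOnce)
  ...     | false = reassign n (T ∩ T₂) (<-≤-trans (size-∩-strict T T₂ i Ti T₂i) (≤-pred small)) meetViolated
    where
    meetViolated : neighbours rest (T ∩ T₂) < demand req (T ∩ T₂)
    meetViolated = uncross 0 (demand-modular req T T₂) (neighbours-submodular rest T T₂)
                     (demand≤1+rest (T ∪ T₂)) violated
                     (<-≤-trans violated₂ (demand-mono T₂ (serveOnce≤ i)))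

  extend : (∀ req′ → HallCondition rest req′ → Assignment rest req′) → Assignment E req
  extend hallRest with hallOrViolation rest req
  ... | inj₁ hall′ = let (d , stored , served) = hallRest req hall′ in
    (λ { zero → nothing ; (suc j) → d j }) , (λ { zero i () ; (suc j) i e → stored j i e }) , served
  ... | inj₂ (T , violated) with reassign (suc (size T)) T ≤-refl violated
  ...   | i , Ei , hall′ = let (d , stored , served) = hallRest (serveOnce req i) hall′ in
    (λ { zero → just i ; (suc j) → d j }) , (λ { zero i′ refl → Ei ; (suc j) i′ e → stored j i′ e }) ,
    λ x → ≤-trans (m≤n+m∸n (req x) (hit (just i) x)) (+-monoʳ-≤ (hit (just i) x) (served x))

hall : ∀ {b} m (E : Fin b → Fin m → Bool) (req : Fin b → ℕ) → HallCondition E req → Assignment E req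
hall zero    E req hallE = (λ ()) , (λ ()) , λ i →
  ≤-trans (term≤∑ req i) (≤-trans (≤-reflexive (sym (demand-⊤ req))) (hallE ⊤))
hall (suc m) E req hallE = RemoveServerZero.extend E req hallE (hall m (RemoveServerZero.rest E req hallE))


-- 4. Union bound for blocks pairwise meeting in at most one point

coverage : ℕ → ℕ → ℕ
coverage ℓ zero    = 0
coverage ℓ (suc t) = coverage ℓ t + (ℓ ∸ t)

someIn≤count : ∀ {n} (T : Subset n) g → 𝟙 (someIn T g) ≤ count (λ i → lookup T i ∧ g i)
someIn≤count T g with someIn T g in e
... | false = z≤n
... | true  = let (i , Ti , gi) = someIn-witness T g e in
  ≤-trans (𝟙-mono (λ _ → cong₂ _∧_ Ti gi)) (term≤∑ (λ i → 𝟙 (lookup T i ∧ g i)) i)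

meetUnion≤size : ∀ {n m} (A : Fin m → Bool) (E : Fin n → Fin m → Bool) →
  (∀ i → count (λ x → A x ∧ E i x) ≤ 1) →
  ∀ T → count (λ x → A x ∧ someIn T (λ i → E i x)) ≤ size T
meetUnion≤size {m = m} A E meetsOnce T = begin
  count (λ x → A x ∧ someIn T (λ i → E i x))           ≤⟨ ∑-mono pointwise ⟩
  ∑ (λ x → count (λ i → lookup T i ∧ (A x ∧ E i x)))   ≡⟨ ∑-swap (λ x i → 𝟙 (lookup T i ∧ (A x ∧ E i x))) ⟩
  ∑ (λ i → count (λ x → lookup T i ∧ (A x ∧ E i x)))   ≤⟨ ∑-mono perBlock ⟩
  size T                                               ∎
  where
  open ≤-Reasoning
  pointwise : ∀ x → 𝟙 (A x ∧ someIn T (λ i → E i x)) ≤ count (λ i → lookup T i ∧ (A x ∧ E i x))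
  pointwise x with A x
  ... | true  = someIn≤count T (λ i → E i x)
  ... | false = z≤n
  perBlock : ∀ i → count (λ x → lookup T i ∧ (A x ∧ E i x)) ≤ 𝟙 (lookup T i)
  perBlock i with lookup T i
  ... | true  = meetsOnce i
  ... | false = ≤-reflexive (∑-zero {m})

-- Adding a block of size ℓ meeting the previous union U′ in I ≤ t points:
-- if |U| + I = ℓ + |U′| and c ≤ |U′| ≤ |U|, then c + (ℓ ∸ t) ≤ |U|.
addBlock : ∀ {u i ℓ n c t} → u + i ≡ ℓ + n → i ≤ t → n ≤ u → c ≤ n → c + (ℓ ∸ t) ≤ u
addBlock {u} {i} {ℓ} {n} {c} {t} modular i≤t n≤u c≤n with ℓ ≤? t
... | yes ℓ≤t rewrite m≤n⇒m∸n≡0 ℓ≤t | +-identityʳ c = ≤-trans c≤n n≤u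
... | no  ℓ≰t = +-cancelʳ-≤ t _ _ (begin
  c + (ℓ ∸ t) + t ≡⟨ +-assoc c (ℓ ∸ t) t ⟩
  c + (ℓ ∸ t + t) ≡⟨ cong (c +_) (m∸n+n≡m (<⇒≤ (≰⇒> ℓ≰t))) ⟩
  c + ℓ           ≤⟨ +-monoˡ-≤ ℓ c≤n ⟩
  n + ℓ           ≡⟨ trans (+-comm n ℓ) (sym modular) ⟩
  u + i           ≤⟨ +-monoʳ-≤ u i≤t ⟩
  u + t           ∎)
  where open ≤-Reasoning

unionBound : ∀ {n m} ℓ (E : Fin n → Fin m → Bool) → (∀ i → count (E i) ≡ ℓ) →
  (∀ i j → i ≢ j → count (λ x → E i x ∧ E j x) ≤ 1) →
  ∀ T → coverage ℓ (size T) ≤ neighbours E T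
unionBound ℓ E sizes meets []          = z≤n
unionBound ℓ E sizes meets (false ∷ T) = unionBound ℓ (λ i → E (suc i)) (λ i → sizes (suc i))
  (λ i j i≢j → meets (suc i) (suc j) (λ e → i≢j (Fin-suc-injective e))) T
unionBound ℓ E sizes meets (true ∷ T)  =
  addBlock modular (meetUnion≤size (E zero) E′ (λ i → meets zero (suc i) (λ ())) T)
           (count-mono (λ x e → trans (cong (E zero x ∨_) e) (∨-zeroʳ _)))
           (unionBound ℓ E′ (λ i → sizes (suc i)) meets′ T)
  where
  E′ : Fin _ → Fin _ → Bool
  E′ i = E (suc i)
  meets′ : ∀ i j → i ≢ j → count (λ x → E′ i x ∧ E′ j x) ≤ 1
  meets′ i j i≢j = meets (suc i) (suc j) (λ e → i≢j (Fin-suc-injective e))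
  union′ : Fin _ → Bool
  union′ x = someIn T (λ i → E′ i x)
  modular : neighbours E (true ∷ T) + count (λ x → E zero x ∧ union′ x) ≡ ℓ + neighbours E′ T
  modular = trans (count-modular (E zero) union′) (cong (_+ neighbours E′ T) (sizes zero))


-- 5. The arithmetic inequality D ≤ coverage ℓ t

coverage-closed : ∀ ℓ t → t ≤ suc ℓ → 2 * coverage ℓ t + t * t ≡ t * (2 * ℓ + 1)
coverage-closed ℓ zero    _         = refl
coverage-closed ℓ (suc t) (s≤s t≤ℓ) = begin
  2 * (coverage ℓ t + (ℓ ∸ t)) + suc t * suc t          ≡⟨ regroup (coverage ℓ t) t (ℓ ∸ t) ⟩
  (2 * coverage ℓ t + t * t) + (2 * (ℓ ∸ t + t) + 1)
    ≡⟨ cong₂ _+_ (coverage-closed ℓ t (m≤n⇒m≤1+n t≤ℓ)) (cong (λ z → 2 * z + 1) (m∸n+n≡m t≤ℓ)) ⟩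
  t * (2 * ℓ + 1) + (2 * ℓ + 1)                         ≡⟨ +-comm (t * (2 * ℓ + 1)) (2 * ℓ + 1) ⟩
  suc t * (2 * ℓ + 1)                                   ∎
  where
  open ≡-Reasoning
  regroup : ∀ c t d → 2 * (c + d) + suc t * suc t ≡ (2 * c + t * t) + (2 * (d + t) + 1)
  regroup = solve-∀

coverage-mono : ∀ ℓ {s t} → s ≤ t → coverage ℓ s ≤ coverage ℓ t
coverage-mono ℓ s≤t = go (≤⇒≤′ s≤t)
  where
  go : ∀ {s t} → s ≤′ t → coverage ℓ s ≤ coverage ℓ t
  go ≤′-refl          = ≤-refl
  go (≤′-step s≤′t) = ≤-trans (go s≤′t) (m≤m+n _ _)

halve : ∀ {a b} c → 2 * a + c ≤ 2 * b + c → a ≤ b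
halve c le = *-cancelˡ-≤ 2 (+-cancelʳ-≤ c _ _ le)

-- With ℓ = r + v and v < r: a demand D ≤ min(t r, k), where k ≤ (v+1)(2r-1),
-- is at most coverage ℓ t.  Small t use the bound t r, large t the bound k.
coverBound′ : ∀ r v k t D → v < r → k ≤ (v + 1) * (2 * r ∸ 1) →
  D ≤ t * r → D ≤ k → D ≤ coverage (r + v) t
coverBound′ (suc r) v k t D v<r k≤ D≤tr D≤k with t ≤? 2 * v + 1
... | yes small = ≤-trans D≤tr (halve (t * t) (begin
  2 * (t * suc r) + t * t   ≡⟨ expand t (suc r) ⟩
  t * (t + 2 * suc r)       ≤⟨ *-monoʳ-≤ t (≤-trans (+-monoˡ-≤ (2 * suc r) small) (≤-reflexive (rearrange v (suc r)))) ⟩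
  t * (2 * ℓ + 1)           ≡⟨ sym (coverage-closed ℓ t t≤ℓ+1) ⟩
  2 * coverage ℓ t + t * t  ∎))
  where
  open ≤-Reasoning
  ℓ = suc r + v
  expand : ∀ t r → 2 * (t * r) + t * t ≡ t * (t + 2 * r)
  expand = solve-∀
  rearrange : ∀ v r → 2 * v + 1 + 2 * r ≡ 2 * (r + v) + 1
  rearrange = solve-∀
  twice : ∀ v → 2 * v + 1 ≡ suc (v + v)
  twice = solve-∀
  t≤ℓ+1 : t ≤ suc ℓ
  t≤ℓ+1 = ≤-trans small (≤-trans (≤-reflexive (twice v)) (s≤s (+-monoˡ-≤ v (≤-pred (m≤n⇒m≤1+n v<r)))))
... | no  large = ≤-trans D≤k (≤-trans k≤ (≤-trans (halve (s * s) (≤-reflexive (begin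
  2 * ((v + 1) * (2 * suc r ∸ 1)) + s * s ≡⟨ cong (λ z → 2 * ((v + 1) * (z ∸ 1)) + s * s) (*-distribˡ-+ 2 1 r) ⟩
  2 * ((v + 1) * suc (2 * r)) + s * s     ≡⟨ identity r v ⟩
  s * (2 * ℓ + 1)                         ≡⟨ sym (coverage-closed ℓ s s≤ℓ+1) ⟩
  2 * coverage ℓ s + s * s                ∎))) (coverage-mono ℓ (≰⇒> large))))
  where
  open ≡-Reasoning
  ℓ = suc r + v
  s = suc (2 * v + 1)
  identity : ∀ r v → 2 * ((v + 1) * suc (2 * r)) + suc (2 * v + 1) * suc (2 * v + 1)
                   ≡ suc (2 * v + 1) * (2 * (suc r + v) + 1)
  identity = solve-∀
  s≤ℓ+1 : s ≤ suc ℓ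
  s≤ℓ+1 = s≤s (≤-trans (≤-reflexive (twice v)) (s≤s (+-monoˡ-≤ v (≤-pred v<r))))
    where
    twice : ∀ v → 2 * v + 1 ≡ suc (v + v)
    twice = solve-∀

half<⇒< : ∀ ℓ r → ℓ / 2 + 1 ≤ r → ℓ < 2 * r
half<⇒< ℓ r h = begin-strict
  ℓ                     ≡⟨ m≡m%n+[m/n]*n ℓ 2 ⟩
  ℓ % 2 + ℓ / 2 * 2     <⟨ +-monoˡ-< (ℓ / 2 * 2) (m%n<n ℓ 2) ⟩
  2 + ℓ / 2 * 2         ≡⟨ regroup (ℓ / 2) ⟩
  2 * (ℓ / 2 + 1)       ≤⟨ *-monoʳ-≤ 2 h ⟩
  2 * r                 ∎
  where
  open ≤-Reasoning
  regroup : ∀ x → 2 + x * 2 ≡ 2 * (x + 1)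
  regroup = solve-∀

coverBound : ∀ ℓ r k t D → ℓ < 2 * r → r ≤ ℓ → k ≤ (ℓ ∸ r + 1) * (2 * r ∸ 1) →
  D ≤ t * r → D ≤ k → D ≤ coverage ℓ t
coverBound ℓ r k t D ℓ<2r r≤ℓ k≤ with m≤n⇒∃[o]m+o≡n r≤ℓ
... | v , refl = coverBound′ r v k t D v<r (subst (λ w → k ≤ (w + 1) * (2 * r ∸ 1)) (m+n∸m≡n r v) k≤)
  where
  v<r : v < r
  v<r = +-cancelˡ-< r v r (≤-trans ℓ<2r (≤-reflexive (cong (r +_) (+-identityʳ r))))


-- 6. Steiner systems

incidence : ∀ {m b} → (Fin b → Subset m) → Fin b → Fin m → Bool
incidence B i j = lookup (B i) j

∈dualSets : ∀ {m b} (B : Fin b → Subset m) i j → incidence B i j ≡ true → i ∈ dualSets B j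
∈dualSets B i j e = lookup⇒[]= i (dualSets B j) (trans (lookup∘tabulate (λ i → incidence B i j) i) e)

∣dualSets∣ : ∀ {m b} (B : Fin b → Subset m) j → ∣ dualSets B j ∣ ≡ count (λ i → incidence B i j)
∣dualSets∣ B j = trans (∣∣≡count (dualSets B j)) (∑-cong (λ i → cong 𝟙 (lookup∘tabulate (λ i → incidence B i j) i)))

blockCount : ∀ {ℓ m b B} → IsSteiner ℓ m b B → ∀ i → count (incidence B i) ≡ ℓ
blockCount {B = B} S i = trans (sym (∣∣≡count (B i))) (IsSteiner.blockSize S i)

-- Two distinct blocks share at most one point: two common points would lie in
-- two different blocks.
blocksMeetOnce : ∀ {ℓ m b B} → IsSteiner ℓ m b B →
  ∀ i j → i ≢ j → count (λ x → incidence B i x ∧ incidence B j x) ≤ 1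
blocksMeetOnce {B = B} S i j i≢j with count (λ x → incidence B i x ∧ incidence B j x) ≤? 1
... | yes atMostOne = atMostOne
... | no  twoOrMore with count-twoWitnesses _ (≰⇒> twoOrMore)
...   | x , y , x≢y , xij , yij with IsSteiner.pairUnique S x y x≢y
...     | _ , _ , unique = ⊥-elim (i≢j (trans (sym (unique (inBlock i (proj₁ xi) , inBlock i (proj₁ yi))))
                                              (unique (inBlock j (proj₂ xi) , inBlock j (proj₂ yi)))))
  where
  xi = ∧-true xij
  yi = ∧-true yij
  inBlock : ∀ i {z} → incidence B i z ≡ true → z ∈ B i
  inBlock i {z} = lookup⇒[]= z (B i)

incidenceCount : ∀ {ℓ m b B} → IsSteiner ℓ m b B → ℓ * b ≡ ∑ (λ j → ∣ dualSets B j ∣)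
incidenceCount {ℓ} {b = b} {B = B} S = begin
  ℓ * b                                         ≡⟨ *-comm ℓ b ⟩
  b * ℓ                                         ≡⟨ sym (∑-const {b} ℓ) ⟩
  ∑ {b} (λ _ → ℓ)                               ≡⟨ ∑-cong (λ i → sym (blockCount S i)) ⟩
  ∑ (λ i → count (incidence B i))               ≡⟨ ∑-swap (λ i j → 𝟙 (incidence B i j)) ⟩
  ∑ (λ j → count (λ i → incidence B i j))       ≡⟨ ∑-cong (λ j → sym (∣dualSets∣ B j)) ⟩
  ∑ (λ j → ∣ dualSets B j ∣)                    ∎
  where open ≡-Reasoning


theorem12 : (ℓ m b : ℕ) (B : Fin b → Subset m) → IsSteiner ℓ m b B → ℓ < m →
    (r k : ℕ) → ℓ / 2 + 1 ≤ r → r ≤ ℓ → r ≤ k → k ≤ (ℓ ∸ r + 1) * (2 * r ∸ 1) →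
    IsMCBC b (ℓ * b) k m r (dualSets B)
theorem12 ℓ m b B S _ r k half r≤ℓ _ k≤ = incidenceCount S , serve
  where
  serve : ∀ req → ∑ req ≡ k → (∀ i → req i ≤ r) →
    ∃ λ (d : Fin m → Maybe (Fin b)) →
      (∀ j i → d j ≡ just i → i ∈ dualSets B j) × (∀ i → req i ≤ ∑ (λ j → hit (d j) i))
  serve req total bounded =
    let (d , stored , served) = hall m (incidence B) req hallCondition in
    d , (λ j i e → ∈dualSets B i j (stored j i e)) , served
    where
    -- Hall's condition: demand(T) ≤ coverage ℓ |T| ≤ |⋃_{i ∈ T} B_i|.
    hallCondition : HallCondition (incidence B) req
    hallCondition T =
      ≤-trans (coverBound ℓ r k (size T) (demand req T) (half<⇒< ℓ r half) r≤ℓ k≤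
                 (demand≤size* T bounded) (≤-trans (demand≤total req T) (≤-reflexive total)))
              (unionBound ℓ (incidence B) (blockCount S) (blocksMeetOnce S) T)
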